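{- Let $A$ be a finite set with $|A|=r$. Let $H$ be a finite graph in which each vertex $v$ carries a support $\sigma(v)\subseteq A$, such that distinct vertices $u,v$ are adjacent iff $\sigma(u)\cap\sigma(v)=\emptyset$, and such that for every $a\in A$ some vertex has support exactly $\{a\}$. Let $c\ge1$, $k_1,\ldots,k_c\ge 2$, and $M=\sum_{i=1}^c(k_i-1)$. Say that $H$ is forcing if every coloring of $V(H)$ with colors $1,\ldots,c$ has some color $i$ whose color class contains a clique of $H$ with $k_i$ vertices. (a) If exactly one vertex of $H$ has empty support, then $H$ is forcing if and only if $r\ge M$. (b) If every vertex of $H$ has nonempty support, then $H$ is forcing if and only if $r\ge M+1$.
   Context: In case (b), vertices with support equal to all of $A$ are allowed. -}

module Defs where

open import Data.Nat using (ℕ; _∸_)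
open import Data.Fin using (Fin)
open import Data.Fin.Subset using (Subset; _∩_; ⊥)
open import Data.Vec using (tabulate; sum)
open import Data.Product using (Σ; _×_; ∃)
open import Function.Definitions using (Injective)
open import Relation.Binary.PropositionalEquality using (_≡_; _≢_)

Adj : ∀ {n r} → (Fin n → Subset r) → Fin n → Fin n → Set
Adj σ u v = (u ≢ v) × (σ u ∩ σ v ≡ ⊥)

MonoClique : ∀ {n r c} → (Fin n → Subset r) → (Fin n → Fin c) → Fin c → ℕ → Set
MonoClique {n} σ χ i k =
  Σ (Fin k → Fin n) λ f →
    Injective _≡_ _≡_ f ×
    (∀ j → χ (f j) ≡ i) ×
    (∀ j j′ → j ≢ j′ → Adj σ (f j) (f j′))

Forcing : ∀ {n r} → (Fin n → Subset r) → (c : ℕ) → (Fin c → ℕ) → Set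
Forcing {n} σ c k = (χ : Fin n → Fin c) → ∃ λ i → MonoClique σ χ i (k i)

M : (c : ℕ) → (Fin c → ℕ) → ℕ
M c k = sum (tabulate {n = c} (λ i → k i ∸ 1))

{-# OPTIONS --safe #-}
-- The supports {a} (a ∈ A), together with the empty support in case (a), span a
-- clique with p = r (resp. r + 1) vertices, and colouring each vertex by a point
-- of its support (resp. by one extra colour when the support is empty) is a proper
-- colouring with p colours.  So it suffices that a graph with a p-clique and a
-- proper p-colouring is forcing iff M < p.  If M < p, the weighted pigeonhole
-- principle with budgets k_i − 1 finds a colour class meeting the clique in k_i
-- vertices.  If p ≤ M, compose the proper colouring with a map Fin M → Fin c whose
-- fibres are consecutive blocks of sizes k_i − 1: a proper colouring is injective
-- on cliques, so a monochromatic clique of colour i has at most k_i − 1 vertices.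
module Submission where

open import Defs
open import Data.Nat using (ℕ; zero; suc; _+_; _∸_; _≤_; _<_; pred; NonZero; ≢-nonZero; z<s; s≤s; s≤s⁻¹)
open import Data.Nat.Properties using (+-suc; suc-pred; m≤n+m∸n; ∸-monoʳ-<; <⇒≤; ≰⇒>; ≤⇒≯)
open import Data.Fin using (Fin; zero; suc; inject≤; inject₁; fromℕ; splitAt; _↑ˡ_; _↑ʳ_; _≟_)
open import Data.Fin.Properties
  using (suc-injective; inject≤-injective; injective⇒≤; join-splitAt; fromℕ≢inject₁; inject₁-injective)
open import Data.Fin.Subset using (Subset; ⊥; ⁅_⁆; _∩_; _∈_; _∉_; Nonempty)
open import Data.Fin.Subset.Properties
  using (Empty-unique; nonempty?; ∉⊥; x∈⁅x⁆; x∈⁅y⁆⇒x≡y; x∈p∩q⁺; x∈p∩q⁻; ∩-comm; ∩-zeroˡ)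
open import Data.Vec using (tabulate; sum)
open import Data.Vec.Functional using (updateAt; tail; _∷_)
open import Data.Vec.Functional.Properties using (updateAt-updates; updateAt-minimal)
open import Data.Product using (Σ; _×_; ∃; _,_; proj₁; proj₂)
import Data.Product as Product
open import Data.Product.Properties using (Σ-≡,≡→≡)
open import Data.Sum using (inj₁; inj₂; [_,_]′)
open import Function using (_∘_; id)
open import Function.Bundles using (_⇔_; mk⇔)
open import Function.Construct.Composition using (_⇔-∘_)
open import Function.Definitions using (Injective)
open import Relation.Nullary using (¬_; yes; no; contradiction)
open import Relation.Nullary.Decidable using (decidable-stable)
open import Relation.Binary.PropositionalEquality using (_≡_; _≢_; refl; sym; trans; cong; subst)

private
  variable
    A : Set
    m n p r t c : ℕ

record Fibre≥ {A : Set} {m : ℕ} (χ : Fin m → A) (i : A) (t : ℕ) : Set where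
  constructor fibre
  field
    embedding : Fin t → Fin m
    injective : Injective _≡_ _≡_ embedding
    lies-over : ∀ j → χ (embedding j) ≡ i

Fibre≥-empty : {χ : Fin m → A} {i : A} → Fibre≥ χ i 0
Fibre≥-empty = fibre (λ ()) (λ { {()} }) (λ ())

Fibre≥-mono : {χ : Fin m → A} {i : A} → t ≤ p → Fibre≥ χ i p → Fibre≥ χ i t
Fibre≥-mono {t = t} {p} t≤p (fibre h h-inj h-col) = fibre (h ∘ ι) (ι-inj ∘ h-inj) (h-col ∘ ι)
  where
  ι : Fin t → Fin p
  ι j = inject≤ j t≤p
  ι-inj : Injective _≡_ _≡_ ι
  ι-inj = inject≤-injective t≤p t≤p _ _

Fibre≥-suc : {χ : Fin (suc m) → A} {i : A} → Fibre≥ (χ ∘ suc) i t → Fibre≥ χ i t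
Fibre≥-suc (fibre h h-inj h-col) = fibre (suc ∘ h) (h-inj ∘ suc-injective) h-col

Fibre≥-cons : {χ : Fin (suc m) → A} {i : A} → χ zero ≡ i → Fibre≥ (χ ∘ suc) i t → Fibre≥ χ i (suc t)
Fibre≥-cons {m = m} {t = t} {χ = χ} {i} χ₀≡i (fibre h h-inj h-col) = fibre h′ h′-inj h′-col
  where
  h′ : Fin (suc t) → Fin (suc m)
  h′ = zero ∷ suc ∘ h
  h′-inj : Injective _≡_ _≡_ h′
  h′-inj {zero}  {zero}  _ = refl
  h′-inj {suc j} {suc j′} e = cong suc (h-inj (suc-injective e))
  h′-col : ∀ j → χ (h′ j) ≡ i
  h′-col zero    = χ₀≡i
  h′-col (suc j) = h-col j

sum-updateAt-pred : (b : Fin c → ℕ) (i : Fin c) .{{_ : NonZero (b i)}} →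
                    sum (tabulate b) ≡ suc (sum (tabulate (updateAt b i pred)))
sum-updateAt-pred b zero    = cong (_+ sum (tabulate (tail b))) (sym (suc-pred (b zero)))
sum-updateAt-pred b (suc i) =
  trans (cong (b zero +_) (sum-updateAt-pred (tail b) i)) (+-suc (b zero) _)

-- Induction on m: the first point either overflows the budget of its colour, or
-- is paid for by lowering that budget by one.
pigeonhole-weighted : (χ : Fin m → Fin c) (b : Fin c → ℕ) →
                      sum (tabulate b) < m → ∃ λ i → Fibre≥ χ i (suc (b i))
pigeonhole-weighted {suc m} χ b sum<m with b (χ zero) Data.Nat.≟ 0
... | yes b₀≡0 = χ zero , subst (Fibre≥ χ (χ zero) ∘ suc) (sym b₀≡0) (Fibre≥-cons refl Fibre≥-empty)
... | no b₀≢0  = extend (pigeonhole-weighted (χ ∘ suc) b′ sum-b′<m)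
  where
  instance
    b₀-nonZero : NonZero (b (χ zero))
    b₀-nonZero = ≢-nonZero b₀≢0
  b′ : Fin _ → ℕ
  b′ = updateAt b (χ zero) pred
  sum-b′<m : sum (tabulate b′) < m
  sum-b′<m = s≤s⁻¹ (subst (_< suc m) (sum-updateAt-pred b (χ zero)) sum<m)
  extend : ∃ (λ i → Fibre≥ (χ ∘ suc) i (suc (b′ i))) → ∃ λ i → Fibre≥ χ i (suc (b i))
  extend (i , F) with i ≟ χ zero
  ... | yes refl = i , subst (Fibre≥ χ i ∘ suc) b′-suc (Fibre≥-cons refl F)
    where
    b′-suc : suc (b′ i) ≡ b i
    b′-suc = trans (cong suc (updateAt-updates i b)) (suc-pred (b i))
  ... | no i≢χ₀  = i , subst (Fibre≥ χ i ∘ suc) (updateAt-minimal i (χ zero) b i≢χ₀) (Fibre≥-suc F)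

blocks : (b : Fin c → ℕ) → Fin (sum (tabulate b)) → Σ (Fin c) (Fin ∘ b)
blocks {suc c} b x = [ (zero ,_) , Product.map suc id ∘ blocks (tail b) ]′ (splitAt (b zero) x)

unblocks : (b : Fin c → ℕ) → Σ (Fin c) (Fin ∘ b) → Fin (sum (tabulate b))
unblocks b (zero  , y) = y ↑ˡ sum (tabulate (tail b))
unblocks b (suc i , y) = b zero ↑ʳ unblocks (tail b) (i , y)

unblocks-blocks : (b : Fin c → ℕ) (x : Fin (sum (tabulate b))) → unblocks b (blocks b x) ≡ x
unblocks-blocks {suc c} b x with splitAt (b zero) x | join-splitAt (b zero) (sum (tabulate (tail b))) x
... | inj₁ y | refl = refl
... | inj₂ z | refl = cong (b zero ↑ʳ_) (unblocks-blocks (tail b) z)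

blocks-injective : (b : Fin c → ℕ) → Injective _≡_ _≡_ (blocks b)
blocks-injective b {x} {y} e =
  trans (sym (unblocks-blocks b x)) (trans (cong (unblocks b) e) (unblocks-blocks b y))

blockColour : (b : Fin c → ℕ) → Fin (sum (tabulate b)) → Fin c
blockColour b = proj₁ ∘ blocks b

Fibre≥-blockColour : (b : Fin c → ℕ) {i : Fin c} → Fibre≥ (blockColour b) i t → t ≤ b i
Fibre≥-blockColour {t = t} b {i} (fibre h h-inj h-col) = injective⇒≤ g-inj
  where
  g : Fin t → Fin (b i)
  g j = subst (Fin ∘ b) (h-col j) (proj₂ (blocks b (h j)))
  blocks-h : ∀ j → blocks b (h j) ≡ (i , g j)
  blocks-h j = Σ-≡,≡→≡ (h-col j , refl)
  g-inj : Injective _≡_ _≡_ g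
  g-inj {j} {j′} e =
    h-inj (blocks-injective b (trans (blocks-h j) (trans (cong (i ,_) e) (sym (blocks-h j′)))))

module _ (σ : Fin n → Subset r) where

  IsClique : (Fin m → Fin n) → Set
  IsClique f = ∀ j j′ → j ≢ j′ → Adj σ (f j) (f j′)

  Clique : ℕ → Set
  Clique m = Σ (Fin m → Fin n) IsClique

  IsProperColouring : (Fin n → A) → Set
  IsProperColouring w = ∀ {u v} → Adj σ u v → w u ≢ w v

  ProperColouring : ℕ → Set
  ProperColouring p = Σ (Fin n → Fin p) IsProperColouring

module _ {σ : Fin n → Subset r} where

  Adj-sym : ∀ {u v} → Adj σ u v → Adj σ v u
  Adj-sym {u} {v} (u≢v , disjoint) = u≢v ∘ sym , trans (∩-comm (σ v) (σ u)) disjoint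

  IsClique-cons : ∀ {v} {f : Fin m → Fin n} → IsClique σ f → (∀ j → Adj σ v (f j)) → IsClique σ (v ∷ f)
  IsClique-cons f-clique v-adj zero    zero     0≢0 = contradiction refl 0≢0
  IsClique-cons f-clique v-adj zero    (suc j′) _   = v-adj j′
  IsClique-cons f-clique v-adj (suc j) zero     _   = Adj-sym (v-adj j)
  IsClique-cons f-clique v-adj (suc j) (suc j′) s≢s = f-clique j j′ (s≢s ∘ cong suc)

  IsProperColouring∘IsClique-injective : {w : Fin n → A} {f : Fin m → Fin n} →
    IsProperColouring σ w → IsClique σ f → Injective _≡_ _≡_ (w ∘ f)
  IsProperColouring∘IsClique-injective w-proper f-clique {j} {j′} e =
    decidable-stable (j ≟ j′) (λ j≢j′ → w-proper (f-clique j j′ j≢j′) e)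

  IsClique-injective : {f : Fin m → Fin n} → IsClique σ f → Injective _≡_ _≡_ f
  IsClique-injective = IsProperColouring∘IsClique-injective proj₁

  Fibre≥⇒MonoClique : (χ : Fin n → Fin c) {i : Fin c} ((f , _) : Clique σ m) →
                      Fibre≥ (χ ∘ f) i t → MonoClique σ χ i t
  Fibre≥⇒MonoClique χ (f , f-clique) (fibre h h-inj h-col) =
    f ∘ h , h-inj ∘ IsClique-injective f-clique , h-col , λ j j′ j≢j′ → f-clique _ _ (j≢j′ ∘ h-inj)

  MonoClique⇒Fibre≥ : (w : Fin n → Fin p) {χ : Fin p → Fin c} {i : Fin c} →
                      IsProperColouring σ w → MonoClique σ (χ ∘ w) i t → Fibre≥ χ i t
  MonoClique⇒Fibre≥ w w-proper (f , _ , f-col , f-clique) =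
    fibre (w ∘ f) (IsProperColouring∘IsClique-injective w-proper f-clique) f-col

  module _ {k : Fin c → ℕ} where

    Clique⇒Forcing : Clique σ m → M c k < m → Forcing σ c k
    Clique⇒Forcing clique M<m χ =
      let i , F = pigeonhole-weighted (χ ∘ proj₁ clique) (λ i → k i ∸ 1) M<m
      in  i , Fibre≥⇒MonoClique χ clique (Fibre≥-mono (m≤n+m∸n (k i) 1) F)

    ProperColouring⇒¬Forcing : (∀ i → 1 ≤ k i) → ProperColouring σ p → p ≤ M c k → ¬ Forcing σ c k
    ProperColouring⇒¬Forcing k≥1 (w , w-proper) p≤M forcing =
      let i , F = forcing (blockColour b ∘ ψ)
      in  ≤⇒≯ (Fibre≥-blockColour b (MonoClique⇒Fibre≥ ψ ψ-proper F)) (∸-monoʳ-< z<s (k≥1 i))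
      where
      b : Fin c → ℕ
      b i = k i ∸ 1
      ψ : Fin n → Fin (M c k)
      ψ v = inject≤ (w v) p≤M
      ψ-proper : IsProperColouring σ ψ
      ψ-proper adj = w-proper adj ∘ inject≤-injective p≤M p≤M _ _

    Forcing⇔M< : (∀ i → 1 ≤ k i) → Clique σ p → ProperColouring σ p → Forcing σ c k ⇔ M c k < p
    Forcing⇔M< k≥1 clique colouring = mk⇔
      (λ forcing → ≰⇒> (λ p≤M → ProperColouring⇒¬Forcing k≥1 colouring p≤M forcing))
      (Clique⇒Forcing clique)

⁅⁆-injective : {a b : Fin r} → ⁅ a ⁆ ≡ ⁅ b ⁆ → a ≡ b
⁅⁆-injective {a = a} {b} e = x∈⁅y⁆⇒x≡y b (subst (a ∈_) e (x∈⁅x⁆ a))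

⁅⁆≢⊥ : (a : Fin r) → ⁅ a ⁆ ≢ ⊥
⁅⁆≢⊥ a e = ∉⊥ (subst (a ∈_) e (x∈⁅x⁆ a))

disjoint⇒∉ : {p q : Subset r} {x : Fin r} → p ∩ q ≡ ⊥ → x ∈ p → x ∉ q
disjoint⇒∉ {x = x} p∩q≡⊥ x∈p x∈q = ∉⊥ (subst (x ∈_) p∩q≡⊥ (x∈p∩q⁺ (x∈p , x∈q)))

⁅⁆-disjoint : {a b : Fin r} → a ≢ b → ⁅ a ⁆ ∩ ⁅ b ⁆ ≡ ⊥
⁅⁆-disjoint {a = a} {b} a≢b = Empty-unique λ (x , x∈⁅a⁆∩⁅b⁆) →
  let x∈⁅a⁆ , x∈⁅b⁆ = x∈p∩q⁻ ⁅ a ⁆ ⁅ b ⁆ x∈⁅a⁆∩⁅b⁆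
  in  a≢b (trans (sym (x∈⁅y⁆⇒x≡y a x∈⁅a⁆)) (x∈⁅y⁆⇒x≡y b x∈⁅b⁆))

≢⊥⇒Nonempty : {p : Subset r} → p ≢ ⊥ → Nonempty p
≢⊥⇒Nonempty {p = p} p≢⊥ = decidable-stable (nonempty? p) (p≢⊥ ∘ Empty-unique)

supportColour : Subset r → Fin (suc r)
supportColour {r} p with nonempty? p
... | yes (x , _) = inject₁ x
... | no _        = fromℕ r

supportColour-disjoint : {p q : Subset r} → p ∩ q ≡ ⊥ → supportColour p ≡ supportColour q → p ≡ ⊥ × q ≡ ⊥
supportColour-disjoint {p = p} {q} p∩q≡⊥ e with nonempty? p | nonempty? q
... | yes (x , x∈p) | yes (_ , y∈q) =
  contradiction (subst (_∈ q) (sym (inject₁-injective e)) y∈q) (disjoint⇒∉ p∩q≡⊥ x∈p)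
... | yes _ | no _  = contradiction (sym e) fromℕ≢inject₁
... | no _  | yes _ = contradiction e fromℕ≢inject₁
... | no ¬p | no ¬q = Empty-unique ¬p , Empty-unique ¬q

module _ {σ : Fin n → Subset r} where

  Adj-by-supports : ∀ {u v} {p q : Subset r} → σ u ≡ p → σ v ≡ q → p ∩ q ≡ ⊥ → p ≢ q → Adj σ u v
  Adj-by-supports refl refl p∩q≡⊥ p≢q = p≢q ∘ cong σ , p∩q≡⊥

  singletons-isClique : (singleton : ∀ a → ∃ λ v → σ v ≡ ⁅ a ⁆) → IsClique σ (proj₁ ∘ singleton)
  singletons-isClique singleton a a′ a≢a′ =
    Adj-by-supports (proj₂ (singleton a)) (proj₂ (singleton a′)) (⁅⁆-disjoint a≢a′) (a≢a′ ∘ ⁅⁆-injective)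

  emptySupport∷singletons-isClique : ∀ {e} → σ e ≡ ⊥ → (singleton : ∀ a → ∃ λ v → σ v ≡ ⁅ a ⁆) →
                                     IsClique σ (e ∷ proj₁ ∘ singleton)
  emptySupport∷singletons-isClique σe≡⊥ singleton = IsClique-cons (singletons-isClique singleton) λ a →
    Adj-by-supports σe≡⊥ (proj₂ (singleton a)) (∩-zeroˡ ⁅ a ⁆) (⁅⁆≢⊥ a ∘ sym)

  choice-isProperColouring : (ne : ∀ v → Nonempty (σ v)) → IsProperColouring σ (proj₁ ∘ ne)
  choice-isProperColouring ne {u} {v} (_ , σu∩σv≡⊥) e =
    disjoint⇒∉ σu∩σv≡⊥ (proj₂ (ne u)) (subst (_∈ σ v) (sym e) (proj₂ (ne v)))

  supportColour-isProperColouring : (∀ {u v} → σ u ≡ ⊥ → σ v ≡ ⊥ → u ≡ v) →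
                                    IsProperColouring σ (supportColour ∘ σ)
  supportColour-isProperColouring emptySupport-unique (u≢v , σu∩σv≡⊥) e =
    let σu≡⊥ , σv≡⊥ = supportColour-disjoint σu∩σv≡⊥ e
    in  u≢v (emptySupport-unique σu≡⊥ σv≡⊥)

theorem4p1 : (r n : ℕ) (σ : Fin n → Subset r) →
    (∀ (a : Fin r) → ∃ λ v → σ v ≡ ⁅ a ⁆) →
    (c : ℕ) → 1 ≤ c → (k : Fin c → ℕ) → (∀ i → 2 ≤ k i) →
    ((∃ λ v → (σ v ≡ ⊥) × (∀ u → σ u ≡ ⊥ → u ≡ v)) →
       Forcing σ c k ⇔ (M c k ≤ r))
    ×
    ((∀ v → σ v ≢ ⊥) →
       Forcing σ c k ⇔ (suc (M c k) ≤ r))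
theorem4p1 r n σ singleton c _ k k≥2 = part-a , part-b
  where
  k≥1 : ∀ i → 1 ≤ k i
  k≥1 i = <⇒≤ (k≥2 i)

  part-a : (∃ λ v → (σ v ≡ ⊥) × (∀ u → σ u ≡ ⊥ → u ≡ v)) → Forcing σ c k ⇔ (M c k ≤ r)
  part-a (e , σe≡⊥ , e-unique) =
    mk⇔ s≤s⁻¹ s≤s ⇔-∘ Forcing⇔M< k≥1
      (e ∷ proj₁ ∘ singleton , emptySupport∷singletons-isClique σe≡⊥ singleton)
      (supportColour ∘ σ , supportColour-isProperColouring λ σu≡⊥ σv≡⊥ →
        trans (e-unique _ σu≡⊥) (sym (e-unique _ σv≡⊥)))

  part-b : (∀ v → σ v ≢ ⊥) → Forcing σ c k ⇔ (suc (M c k) ≤ r)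
  part-b σ≢⊥ = Forcing⇔M< k≥1
    (proj₁ ∘ singleton , singletons-isClique singleton)
    (proj₁ ∘ nonempty , choice-isProperColouring nonempty)
    where
    nonempty : ∀ v → Nonempty (σ v)
    nonempty = ≢⊥⇒Nonempty ∘ σ≢⊥
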